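{- Let $\mathbf A,\mathbf B$ be t-algebras of type $\tau$ and let $f:\mathbf A\to\mathbf B$ be an onto t-homomorphism. Then the correspondence $t^{\mathbf A}\mapsto t^{\mathbf B}$ ($t$ a $\tau$-term) is a well-defined homomorphism of clone $\tau$-algebras from $\mathbf A^{\uparrow}$ onto $\mathbf B^{\uparrow}$.
   Context: $\mathbb N=\{1,2,\dots\}$. Threads on $A$: elements of $A^{\mathbb N}$; $r[a_1,..,a_n]$ replaces the first $n$ entries of $r$. A trace on $A$: nonempty $\mathsf a\subseteq A^{\mathbb N}$ closed under changing finitely many entries. $f^{\mathbb N}(s)=(f(s_i))_i$. A t-algebra of type $\tau$, trace $\mathsf a$: $(A,\mathsf a,\sigma^{\mathbf A})_{\sigma\in\tau}$, $\sigma^{\mathbf A}:\mathsf a\to A$. An onto t-homomorphism $f:\mathbf A\to\mathbf B$ (traces $\mathsf a,\mathsf b$) is a map $f:A\to B$ such that $f^{\mathbb N}$ maps $\mathsf a$ onto $\mathsf b$, $f$ is surjective, and $f(\sigma^{\mathbf A}(s))=\sigma^{\mathbf B}(f^{\mathbb N}(s))$ for all $s\in\mathsf a$, $\sigma\in\tau$. $\tau$-terms: $\mathsf e_i$ and $\sigma(t_1,..,t_n,\mathsf e_{n+1},..)$; $\mathsf e_i^{\mathbf A}(s)=s_i$, $\sigma(t_1,..,t_n,\mathsf e_{n+1},..)^{\mathbf A}(s)=\sigma^{\mathbf A}(s[t_1^{\mathbf A}(s),..,t_n^{\mathbf A}(s)])$. $\mathbf A^{\uparrow}$ is the clone $\tau$-algebra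 with universe $\{t^{\mathbf A}:t$ a $\tau$-term$\}$, constants $\mathsf e_i^{\mathbf A}$ and $\sigma^{\mathbf A}$, and $q_n(\varphi,\psi_1,..,\psi_n)(s)=\varphi(s[\psi_1(s),..,\psi_n(s)])$; a homomorphism of clone $\tau$-algebras preserves all $q_n$, $\mathsf e_i$ and $\sigma$. -}

module Defs where

open import Data.Nat using (ℕ; zero; suc; _≤_; z≤n; s≤s)
open import Data.List using (List; []; _∷_; length; map)
open import Data.Product using (Σ; Σ-syntax; ∃; _×_; _,_; proj₁; proj₂)
open import Relation.Binary.PropositionalEquality using (_≡_; refl)

-- Convention: a thread s = (s₁, s₂, …) ∈ A^ℕ is represented as a function
-- ℕ → A with Agda index k standing for the paper's index k+1.
Thread : Set → Set
Thread A = ℕ → A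

upd : {A : Set} → Thread A → List A → Thread A
upd r []       i       = r i
upd r (x ∷ xs) zero    = x
upd r (x ∷ xs) (suc i) = upd (λ j → r (suc j)) xs i

upd-far : {A : Set} (r : Thread A) (xs : List A) (i : ℕ) →
          length xs ≤ i → upd r xs i ≡ r i
upd-far r []       i       _         = refl
upd-far r (x ∷ xs) (suc i) (s≤s le)  = upd-far (λ j → r (suc j)) xs i le

FinDiff : {A : Set} → Thread A → Thread A → Set
FinDiff s r = Σ ℕ λ n → ∀ i → n ≤ i → s i ≡ r i

record Trace (A : Set) : Set₁ where
  field
    _∈t    : Thread A → Set
    nonempty : Σ (Thread A) _∈t
    closed : ∀ s r → s ∈t → FinDiff s r → r ∈t
open Trace public

Elt : {A : Set} → Trace A → Set
Elt {A} 𝖺 = Σ (Thread A) (_∈t 𝖺)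

upd-∈ : {A : Set} (𝖺 : Trace A) (x : Elt 𝖺) (xs : List A) → _∈t 𝖺 (upd (proj₁ x) xs)
upd-∈ 𝖺 (s , p) xs = closed 𝖺 s (upd s xs) p (length xs , λ i le → Relation.Binary.PropositionalEquality.sym (upd-far s xs i le))
  where import Relation.Binary.PropositionalEquality

updE : {A : Set} (𝖺 : Trace A) → Elt 𝖺 → List A → Elt 𝖺
updE 𝖺 x xs = upd (proj₁ x) xs , upd-∈ 𝖺 x xs

Op : {A : Set} → Trace A → Set
Op {A} 𝖺 = Elt 𝖺 → A

OpEq : {A : Set} (𝖺 : Trace A) → Op 𝖺 → Op 𝖺 → Set
OpEq 𝖺 φ ψ = ∀ x → φ x ≡ ψ x
syntax OpEq 𝖺 φ ψ = φ ≈[ 𝖺 ] ψ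

-- The field σ-cong expresses that σ^A is a genuine function on the set 𝖺
-- (threads are compared pointwise, membership proofs are irrelevant).
record TAlg (τ : Set) : Set₁ where
  field
    Carrier : Set
    trace   : Trace Carrier
    op      : τ → Op trace
    op-cong : ∀ σ (x y : Elt trace) → (∀ i → proj₁ x i ≡ proj₁ y i) → op σ x ≡ op σ y
open TAlg public

-- τ-terms: 𝖾ᵢ (var i, i.e. 𝖾_{i+1}) and σ(t₁,…,tₙ,𝖾_{n+1},…) (app σ (t₁ ∷ … ∷ tₙ ∷ [])).
data Term (τ : Set) : Set where
  var : ℕ → Term τ
  app : τ → List (Term τ) → Term τ

module _ {τ : Set} (𝐀 : TAlg τ) where
  mutual
    ⟦_⟧ : Term τ → Op (trace 𝐀)
    ⟦ var i ⟧    x = proj₁ x i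
    ⟦ app σ ts ⟧ x = op 𝐀 σ (updE (trace 𝐀) x (⟦_⟧* ts x))

    ⟦_⟧* : List (Term τ) → Elt (trace 𝐀) → List (Carrier 𝐀)
    ⟦ [] ⟧*     x = []
    ⟦ t ∷ ts ⟧* x = ⟦ t ⟧ x ∷ ⟦ ts ⟧* x

  IsTermOp : Op (trace 𝐀) → Set
  IsTermOp φ = Σ (Term τ) λ t → φ ≈[ trace 𝐀 ] ⟦ t ⟧

  CloneUniv : Set
  CloneUniv = Σ (Op (trace 𝐀)) IsTermOp

  q : Op (trace 𝐀) → List (Op (trace 𝐀)) → Op (trace 𝐀)
  q φ ψs x = φ (updE (trace 𝐀) x (map (λ ψ → ψ x) ψs))

  𝖾 : ℕ → Op (trace 𝐀)
  𝖾 i x = proj₁ x i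

record OntoTHom {τ : Set} (𝐀 𝐁 : TAlg τ) : Set where
  field
    fun      : Carrier 𝐀 → Carrier 𝐁
    surj     : ∀ b → Σ (Carrier 𝐀) λ a → fun a ≡ b
    mapsTo   : (x : Elt (trace 𝐀)) → _∈t (trace 𝐁) (λ i → fun (proj₁ x i))
    mapsOnto : (y : Elt (trace 𝐁)) → Σ (Elt (trace 𝐀)) λ x → ∀ i → fun (proj₁ x i) ≡ proj₁ y i
    hom      : ∀ σ (x : Elt (trace 𝐀)) →
               fun (op 𝐀 σ x) ≡ op 𝐁 σ ((λ i → fun (proj₁ x i)) , mapsTo x)
open OntoTHom public

-- F : A↑ → B↑ is a homomorphism of clone τ-algebras from A↑ onto B↑
-- (A↑, B↑ are setoids under pointwise equality of operations).
record IsOntoCloneHom {τ : Set} (𝐀 𝐁 : TAlg τ) (F : CloneUniv 𝐀 → CloneUniv 𝐁) : Set where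
  field
    F-cong : ∀ φ ψ → proj₁ φ ≈[ trace 𝐀 ] proj₁ ψ → proj₁ (F φ) ≈[ trace 𝐁 ] proj₁ (F ψ)
    F-q    : ∀ (φ : CloneUniv 𝐀) (ψs : List (CloneUniv 𝐀)) (χ : CloneUniv 𝐀) →
             proj₁ χ ≈[ trace 𝐀 ] q 𝐀 (proj₁ φ) (map proj₁ ψs) →
             proj₁ (F χ) ≈[ trace 𝐁 ] q 𝐁 (proj₁ (F φ)) (map (λ ψ → proj₁ (F ψ)) ψs)
    F-𝖾    : ∀ i (χ : CloneUniv 𝐀) → proj₁ χ ≈[ trace 𝐀 ] 𝖾 𝐀 i → proj₁ (F χ) ≈[ trace 𝐁 ] 𝖾 𝐁 i
    F-σ    : ∀ σ (χ : CloneUniv 𝐀) → proj₁ χ ≈[ trace 𝐀 ] op 𝐀 σ → proj₁ (F χ) ≈[ trace 𝐁 ] op 𝐁 σ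
    F-onto : ∀ (ψ : CloneUniv 𝐁) → Σ (CloneUniv 𝐀) λ φ → proj₁ (F φ) ≈[ trace 𝐁 ] proj₁ ψ

_↑ : {τ : Set} {𝐀 : TAlg τ} → Term τ → CloneUniv 𝐀
_↑ {𝐀 = 𝐀} t = ⟦_⟧ 𝐀 t , (t , λ x → refl)

{-# OPTIONS --safe #-}
-- Write x ↦ y when f^ℕ x = y, and φ ↦ᵒ Φ when x ↦ y always gives f (φ x) = Φ y.
-- Then t^A ↦ᵒ t^B for every term t, 𝖾ᵢ^A ↦ᵒ 𝖾ᵢ^B, σ^A ↦ᵒ σ^B, and ↦ᵒ is
-- preserved by the clone operations qₙ. Since f^ℕ maps 𝖺 onto 𝖻, Φ is determined
-- by any φ with φ ↦ᵒ Φ, so t^A ↦ t^B is well defined and every equation in A↑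
-- among these operations transfers to B↑.
module Submission where

open import Defs
open import Data.Product using (Σ; _×_; proj₁; proj₂; _,_)
open import Data.Nat using (zero; suc)
open import Data.List using (List; []; _∷_; map)
open import Data.List.Relation.Binary.Pointwise using (Pointwise; []; _∷_)
open import Relation.Binary.PropositionalEquality

upd-cong : {A : Set} {r r′ : Thread A} → (∀ i → r i ≡ r′ i) →
           (xs : List A) → ∀ i → upd r xs i ≡ upd r′ xs i
upd-cong r≗r′ []       i       = r≗r′ i
upd-cong r≗r′ (x ∷ xs) zero    = refl
upd-cong r≗r′ (x ∷ xs) (suc i) = upd-cong (λ j → r≗r′ (suc j)) xs i

upd-map : {A B : Set} (g : A → B) (r : Thread A) (xs : List A) →
          ∀ i → g (upd r xs i) ≡ upd (λ j → g (r j)) (map g xs) i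
upd-map g r []       i       = refl
upd-map g r (x ∷ xs) zero    = refl
upd-map g r (x ∷ xs) (suc i) = upd-map g (λ j → r (suc j)) xs i

module _ {τ : Set} {𝐀 𝐁 : TAlg τ} (h : OntoTHom 𝐀 𝐁) where

  private
    f = fun h

  _↦_ : Elt (trace 𝐀) → Elt (trace 𝐁) → Set
  x ↦ y = ∀ i → f (proj₁ x i) ≡ proj₁ y i

  _↦ᵒ_ : Op (trace 𝐀) → Op (trace 𝐁) → Set
  φ ↦ᵒ Φ = ∀ x y → x ↦ y → f (φ x) ≡ Φ y

  ↦ᵒ-unique : {φ ψ : Op (trace 𝐀)} {Φ Ψ : Op (trace 𝐁)} →
              φ ↦ᵒ Φ → ψ ↦ᵒ Ψ → φ ≈[ trace 𝐀 ] ψ → Φ ≈[ trace 𝐁 ] Ψ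
  ↦ᵒ-unique {φ} {ψ} {Φ} {Ψ} φ↦Φ ψ↦Ψ φ≈ψ y = begin
      Φ y      ≡⟨ sym (φ↦Φ x y x↦y) ⟩
      f (φ x)  ≡⟨ cong f (φ≈ψ x) ⟩
      f (ψ x)  ≡⟨ ψ↦Ψ x y x↦y ⟩
      Ψ y      ∎
    where
      open ≡-Reasoning
      x   = proj₁ (mapsOnto h y)
      x↦y = proj₂ (mapsOnto h y)

  ↦ᵒ-respˡ-≈ : {φ ψ : Op (trace 𝐀)} {Φ : Op (trace 𝐁)} →
               φ ≈[ trace 𝐀 ] ψ → ψ ↦ᵒ Φ → φ ↦ᵒ Φ
  ↦ᵒ-respˡ-≈ φ≈ψ ψ↦Φ x y x↦y = trans (cong f (φ≈ψ x)) (ψ↦Φ x y x↦y)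

  updE-↦ : ∀ {x y} → x ↦ y → (as : List (Carrier 𝐀)) {bs : List (Carrier 𝐁)} →
           map f as ≡ bs → updE (trace 𝐀) x as ↦ updE (trace 𝐁) y bs
  updE-↦ {x} {y} x↦y as refl i =
    trans (upd-map f (proj₁ x) as i) (upd-cong x↦y (map f as) i)

  𝖾-↦ᵒ : ∀ i → 𝖾 𝐀 i ↦ᵒ 𝖾 𝐁 i
  𝖾-↦ᵒ i x y x↦y = x↦y i

  op-↦ᵒ : ∀ σ → op 𝐀 σ ↦ᵒ op 𝐁 σ
  op-↦ᵒ σ x y x↦y = trans (hom h σ x) (op-cong 𝐁 σ _ y x↦y)

  eval-↦ : ∀ {ψs Ψs} → Pointwise _↦ᵒ_ ψs Ψs → ∀ {x y} → x ↦ y →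
           map f (map (λ ψ → ψ x) ψs) ≡ map (λ Ψ → Ψ y) Ψs
  eval-↦ []             x↦y = refl
  eval-↦ (ψ↦Ψ ∷ ψs↦Ψs) x↦y = cong₂ _∷_ (ψ↦Ψ _ _ x↦y) (eval-↦ ψs↦Ψs x↦y)

  q-↦ᵒ : ∀ {φ Φ ψs Ψs} → φ ↦ᵒ Φ → Pointwise _↦ᵒ_ ψs Ψs → q 𝐀 φ ψs ↦ᵒ q 𝐁 Φ Ψs
  q-↦ᵒ {ψs = ψs} φ↦Φ ψs↦Ψs x y x↦y =
    φ↦Φ _ _ (updE-↦ {x} {y} x↦y (map (λ ψ → ψ x) ψs) (eval-↦ ψs↦Ψs x↦y))

  mutual
    ⟦⟧-↦ᵒ : ∀ t → ⟦_⟧ 𝐀 t ↦ᵒ ⟦_⟧ 𝐁 t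
    ⟦⟧-↦ᵒ (var i)    = 𝖾-↦ᵒ i
    ⟦⟧-↦ᵒ (app σ ts) x y x↦y =
      op-↦ᵒ σ _ _ (updE-↦ {x} {y} x↦y (⟦_⟧* 𝐀 ts x) (⟦⟧*-↦ ts x↦y))

    ⟦⟧*-↦ : ∀ ts {x y} → x ↦ y → map f (⟦_⟧* 𝐀 ts x) ≡ ⟦_⟧* 𝐁 ts y
    ⟦⟧*-↦ []       x↦y = refl
    ⟦⟧*-↦ (t ∷ ts) x↦y = cong₂ _∷_ (⟦⟧-↦ᵒ t _ _ x↦y) (⟦⟧*-↦ ts x↦y)

termOp↑ : {τ : Set} (𝐀 𝐁 : TAlg τ) → CloneUniv 𝐀 → CloneUniv 𝐁
termOp↑ 𝐀 𝐁 (_ , t , _) = _↑ {𝐀 = 𝐁} t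

module _ {τ : Set} {𝐀 𝐁 : TAlg τ} (h : OntoTHom 𝐀 𝐁) where

  termOp↑-↦ᵒ : (φ : CloneUniv 𝐀) → _↦ᵒ_ h (proj₁ φ) (proj₁ (termOp↑ 𝐀 𝐁 φ))
  termOp↑-↦ᵒ (_ , t , φ≈t) = ↦ᵒ-respˡ-≈ h φ≈t (⟦⟧-↦ᵒ h t)

  termOp↑-↦ᵒ* : (ψs : List (CloneUniv 𝐀)) →
                Pointwise (_↦ᵒ_ h) (map proj₁ ψs) (map (λ ψ → proj₁ (termOp↑ 𝐀 𝐁 ψ)) ψs)
  termOp↑-↦ᵒ* []       = []
  termOp↑-↦ᵒ* (ψ ∷ ψs) = termOp↑-↦ᵒ ψ ∷ termOp↑-↦ᵒ* ψs

  termOp↑-isOntoCloneHom : IsOntoCloneHom 𝐀 𝐁 (termOp↑ 𝐀 𝐁)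
  termOp↑-isOntoCloneHom = record
    { F-cong = λ φ ψ → ↦ᵒ-unique h (termOp↑-↦ᵒ φ) (termOp↑-↦ᵒ ψ)
    ; F-q    = λ φ ψs χ → ↦ᵒ-unique h (termOp↑-↦ᵒ χ)
                            (q-↦ᵒ h (termOp↑-↦ᵒ φ) (termOp↑-↦ᵒ* ψs))
    ; F-𝖾    = λ i χ → ↦ᵒ-unique h (termOp↑-↦ᵒ χ) (𝖾-↦ᵒ h i)
    ; F-σ    = λ σ χ → ↦ᵒ-unique h (termOp↑-↦ᵒ χ) (op-↦ᵒ h σ)
    ; F-onto = λ { (_ , t , ψ≈t) → _↑ {𝐀 = 𝐀} t , λ y → sym (ψ≈t y) }
    }

proposition7p8 : {τ : Set} (𝐀 𝐁 : TAlg τ) → OntoTHom 𝐀 𝐁 →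
    Σ (CloneUniv 𝐀 → CloneUniv 𝐁) λ F →
      ((t : Term τ) → proj₁ (F (_↑ {𝐀 = 𝐀} t)) ≈[ trace 𝐁 ] ⟦_⟧ 𝐁 t)
      × IsOntoCloneHom 𝐀 𝐁 F
proposition7p8 𝐀 𝐁 h = termOp↑ 𝐀 𝐁 , (λ t y → refl) , termOp↑-isOntoCloneHom h
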